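{- For every integer $n\geq1$, every graph $G$ with $\mathrm{td}(G)\geq 2^n-1$ contains a bipartite subgraph $\hat G\subseteq G$ with $\mathrm{td}(\hat G)\geq n$.
   Context: All graphs are finite and simple. The closure of a rooted tree $T$ is the graph obtained from $T$ by adding an edge $uv$ whenever $u$ is an ancestor of $v$; the closure of a rooted forest is the union of the closures of its trees. The height of a rooted tree is the number of vertices on a longest root-to-leaf path, and the height of a rooted forest is the maximum height of its trees. The treedepth $\mathrm{td}(G)$ is the minimum height of a rooted forest whose closure contains $G$ as a subgraph. -}

module Defs where

open import Data.Nat using (ℕ; zero; suc; _≤_)
open import Data.Fin using (Fin)
open import Data.Maybe using (Maybe; just; nothing)
open import Data.Bool using (Bool)
open import Data.Product using (Σ; ∃; _×_; _,_)
open import Data.Sum using (_⊎_)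
open import Relation.Nullary using (¬_)
open import Relation.Binary using (Decidable)
open import Relation.Binary.PropositionalEquality using (_≡_; _≢_)
open import Function.Definitions using (Injective)

record Graph : Set₁ where
  field
    n      : ℕ
    Adj    : Fin n → Fin n → Set
    dec    : Decidable Adj
    sym    : ∀ {u v} → Adj u v → Adj v u
    irrefl : ∀ {u} → ¬ Adj u u
open Graph public

-- H is a subgraph of G (up to isomorphism): an injective vertex map
-- sending edges of H to edges of G.
_⊆ᴳ_ : Graph → Graph → Set
H ⊆ᴳ G = Σ (Fin (n H) → Fin (n G)) λ f →
           Injective _≡_ _≡_ f × (∀ {u v} → Adj H u v → Adj G (f u) (f v))

Bipartite : Graph → Set
Bipartite G = Σ (Fin (n G) → Bool) λ c → ∀ {u v} → Adj G u v → c u ≢ c v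

-- A rooted forest on vertex set Fin m, given by a parent function
-- (nothing = the vertex is a root).
Parent : ℕ → Set
Parent m = Fin m → Maybe (Fin m)

-- RootPath p v k : the path from v up to the root of its tree has exactly
-- k vertices (v included).
data RootPath {m : ℕ} (p : Parent m) : Fin m → ℕ → Set where
  root : ∀ {v} → p v ≡ nothing → RootPath p v 1
  step : ∀ {v u k} → p v ≡ just u → RootPath p u k → RootPath p v (suc k)

record RootedForest : Set where
  field
    m        : ℕ
    parent   : Parent m
    -- every vertex reaches a root (no cycles), so parent describes a forest
    toRoot   : ∀ v → ∃ λ k → RootPath parent v k
open RootedForest public

data Ancestor (F : RootedForest) : Fin (m F) → Fin (m F) → Set where
  par   : ∀ {u v} → parent F v ≡ just u → Ancestor F u v
  up    : ∀ {u w v} → parent F v ≡ just w → Ancestor F u w → Ancestor F u v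

-- Height of F is at most h: every root-to-leaf (equivalently, every
-- vertex-to-root) path has at most h vertices.
HeightAtMost : RootedForest → ℕ → Set
HeightAtMost F h = ∀ v k → RootPath (parent F) v k → k ≤ h

ClosureContains : RootedForest → Graph → Set
ClosureContains F G = Σ (Fin (n G) → Fin (m F)) λ f →
  Injective _≡_ _≡_ f ×
  (∀ {u v} → Adj G u v → Ancestor F (f u) (f v) ⊎ Ancestor F (f v) (f u))

-- td(G) ≥ k : every rooted forest whose closure contains G has height ≥ k,
-- i.e. the minimum height of such a forest is at least k.
TdAtLeast : Graph → ℕ → Set
TdAtLeast G k = ∀ (F : RootedForest) (h : ℕ) →
  ClosureContains F G → HeightAtMost F h → k ≤ h

-- Depth-first search yields a normal spanning forest T of G: every edge of G joins a vertex
-- to one of its ancestors, so the closure of T contains G, and every root path of T is a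
-- path in G.  Hence td(G) ≥ 2ⁿ - 1 gives a path P ⊆ G on at least 2ⁿ - 1 vertices.  P is
-- bipartite, and td(P) ≥ n: in a forest whose closure contains P, some vertex b of P is an
-- ancestor of all of P, and removing b leaves two subpaths strictly below b, one of them on
-- at least 2ⁿ⁻¹ - 1 vertices; by induction some vertex lies n - 1 levels below b.
module Submission where

open import Defs hiding (sym)
open import Data.Nat using (ℕ; zero; suc; _≤_; _<_; _^_; _+_; _∸_; z≤n; s≤s; _≤?_)
open import Data.Nat.Properties
  using ( _≟_; suc-injective; ≤-refl; ≤-reflexive; ≤-trans; <⇒≤; <-irrefl; <⇒≱; ≮⇒≥; ≰⇒>
        ; 1+n≰n; 1+n≢n; 1+n≢0; +-identityʳ; +-suc; +-mono-≤; +-monoˡ-≤; +-mono-<; +-monoʳ-<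
        ; ^-monoʳ-≤; m≤n+m∸n; ∸-monoˡ-≤; module ≤-Reasoning )
open import Data.Nat.Induction using (<-wellFounded)
open import Induction.WellFounded using (Acc; acc)
open import Data.Fin using (Fin; zero; suc; toℕ)
open import Data.Fin.Properties using (any?) renaming (_≟_ to _≟ᶠ_)
open import Data.Fin.Subset using (Subset; ⊤; ⁅_⁆; _-_; ∣_∣; _∈_; _∉_; Empty)
open import Data.Fin.Subset.Properties
  using (∈⊤; p─q⊆p; x∈p∧x≢y⇒x∈p-y; x∈p⇒∣p-x∣<∣p∣; _∈?_; nonempty?)
open import Data.Vec as Vec using (_∷_)
open import Data.Vec.Functional using (updateAt)
open import Data.Vec.Functional.Properties using (updateAt-updates; updateAt-minimal)
open import Data.Maybe using (Maybe; just; nothing; maybe′)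
open import Data.Maybe.Properties using (just-injective)
open import Data.Product using (Σ; ∃; _×_; _,_; proj₁; proj₂; map₁)
open import Data.Sum using (_⊎_; inj₁; inj₂; [_,_]′)
import Data.Sum as Sum
import Data.Product as Product
open import Function using (_∘_; id; const; case_of_)
open import Function.Definitions using (Injective)
open import Data.Empty using (⊥-elim)
open import Data.List using (List; []; _∷_; _++_; length; tabulate)
open import Data.List.Properties using (length-++; length-tabulate)
open import Data.List.Relation.Unary.All as All using (All; []; _∷_)
import Data.List.Relation.Unary.All.Properties as All
open import Data.List.Relation.Unary.AllPairs using (AllPairs; []; _∷_)
open import Data.List.Relation.Unary.Linked as Linked using (Linked; []; [-]; _∷_)
open import Data.List.Relation.Unary.Unique.Propositional using (Unique)
import Data.List.Relation.Unary.Unique.Propositional.Properties as Unique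
open import Data.List.Relation.Unary.Any using (here; there)
open import Relation.Binary using (Rel)
open import Relation.Binary.Construct.Closure.ReflexiveTransitive using (Star; ε; _◅_; _◅◅_)
import Relation.Binary.Construct.Closure.ReflexiveTransitive as Star
open import Relation.Binary.PropositionalEquality
  using (_≡_; _≢_; refl; sym; trans; cong; subst; ≢-sym; module ≡-Reasoning)
open import Relation.Nullary using (¬_; yes; no)
open import Relation.Nullary.Decidable using (_⊎-dec_; _×-dec_)
open import Data.Bool using (Bool; true; not)
open import Data.Bool.Properties using (not-¬)
open import Level using (Level)

private variable
  a ℓ : Level
  A : Set a
  R : Rel A ℓ

Linked-++⁻ : ∀ xs {ys} → Linked R (xs ++ ys) → Linked R xs × Linked R ys
Linked-++⁻ []           l       = [] , l
Linked-++⁻ (x ∷ [])     l       = [-] , Linked.tail l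
Linked-++⁻ (x ∷ y ∷ xs) (r ∷ l) = map₁ (r ∷_) (Linked-++⁻ (y ∷ xs) l)

AllPairs-++⁻ : ∀ xs {ys} → AllPairs R (xs ++ ys) →
               AllPairs R xs × AllPairs R ys × All (λ x → All (R x) ys) xs
AllPairs-++⁻ []       a         = [] , a , []
AllPairs-++⁻ (x ∷ xs) (px ∷ a) with AllPairs-++⁻ xs a
... | axs , ays , across = All.++⁻ˡ xs px ∷ axs , ays , All.++⁻ʳ xs px ∷ across

Consecutive : ∀ {k} → Fin k → Fin k → Set
Consecutive i j = toℕ j ≡ suc (toℕ i)

Linked-tabulate⁺ : ∀ {k} {f : Fin k → A} →
                   (∀ {i j} → Consecutive i j → R (f i) (f j)) → Linked R (tabulate f)
Linked-tabulate⁺ {k = zero}        next = []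
Linked-tabulate⁺ {k = suc zero}    next = [-]
Linked-tabulate⁺ {k = suc (suc k)} next = next refl ∷ Linked-tabulate⁺ (λ e → next (cong suc e))

m+m≤n+o⇒m≤n⊎m≤o : ∀ {m n o} → m + m ≤ n + o → m ≤ n ⊎ m ≤ o
m+m≤n+o⇒m≤n⊎m≤o {m} {n} {o} m+m≤n+o with m ≤? n | m ≤? o
... | yes m≤n | _       = inj₁ m≤n
... | no  _   | yes m≤o = inj₂ m≤o
... | no  m≰n | no  m≰o = ⊥-elim (<⇒≱ (+-mono-< (≰⇒> m≰n) (≰⇒> m≰o)) m+m≤n+o)

longerSide : ∀ j (ls : List A) b rs → 2 ^ suc j ≤ suc (length (ls ++ b ∷ rs)) →
             2 ^ j ≤ suc (length ls) ⊎ 2 ^ j ≤ suc (length rs)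
longerSide j ls b rs long = m+m≤n+o⇒m≤n⊎m≤o (begin
  2 ^ j + 2 ^ j                     ≡⟨ cong (2 ^ j +_) (sym (+-identityʳ (2 ^ j))) ⟩
  2 ^ suc j                         ≤⟨ long ⟩
  suc (length (ls ++ b ∷ rs))       ≡⟨ cong suc (length-++ ls) ⟩
  suc (length ls) + suc (length rs) ∎)
  where open ≤-Reasoning

m<n⇒m+m+suc[o]<n+n+o : ∀ {m n} o → m < n → m + m + suc o < n + n + o
m<n⇒m+m+suc[o]<n+n+o {m} o m<n =
  ≤-trans (≤-reflexive (cong suc reorder)) (+-monoˡ-≤ o (+-mono-≤ m<n m<n))
  where
  reorder : m + m + suc o ≡ m + suc m + o
  reorder = trans (+-suc (m + m) o) (cong (_+ o) (sym (+-suc m m)))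

x∉p-x : ∀ {k} (p : Subset k) x → x ∉ p - x
x∉p-x (_ ∷ p) zero    ()
x∉p-x (_ ∷ p) (suc x) (Vec.there x∈p-x) = x∉p-x p x x∈p-x

module Ancestry {k : ℕ} (p : Parent k) where

  infix 4 _↦_ _↦*_ _↦⁺_

  _↦_ : Fin k → Fin k → Set
  x ↦ w = p x ≡ just w

  _↦*_ : Fin k → Fin k → Set
  _↦*_ = Star _↦_

  _↦⁺_ : Fin k → Fin k → Set
  x ↦⁺ a = ∃ λ w → x ↦ w × w ↦* a

  Comparable : Fin k → Fin k → Set
  Comparable x y = y ↦* x ⊎ x ↦* y

  ↦-functional : ∀ {x a b} → x ↦ a → x ↦ b → a ≡ b
  ↦-functional x↦a x↦b = just-injective (trans (sym x↦a) x↦b)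

  ↦⁺⇒↦* : ∀ {x a} → x ↦⁺ a → x ↦* a
  ↦⁺⇒↦* (_ , x↦w , w↦*a) = x↦w ◅ w↦*a

  ↦*-≢⇒↦⁺ : ∀ {x a} → x ↦* a → x ≢ a → x ↦⁺ a
  ↦*-≢⇒↦⁺ ε              x≢x = ⊥-elim (x≢x refl)
  ↦*-≢⇒↦⁺ (x↦w ◅ w↦*a) _   = _ , x↦w , w↦*a

  ↦*-comparable : ∀ {x a b} → x ↦* a → x ↦* b → Comparable a b
  ↦*-comparable ε              x↦*b          = inj₂ x↦*b
  ↦*-comparable (x↦w ◅ w↦*a)   ε             = inj₁ (x↦w ◅ w↦*a)
  ↦*-comparable (x↦w ◅ w↦*a)   (x↦w′ ◅ w′↦*b)
    with refl ← ↦-functional x↦w x↦w′ = ↦*-comparable w↦*a w′↦*b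

  RootPath-unique : ∀ {v h h′} → RootPath p v h → RootPath p v h′ → h ≡ h′
  RootPath-unique (root _)     (root _)       = refl
  RootPath-unique (root v↦∅)   (step v↦w _)   with () ← trans (sym v↦∅) v↦w
  RootPath-unique (step v↦w _) (root v↦∅)     with () ← trans (sym v↦w) v↦∅
  RootPath-unique (step v↦w r) (step v↦w′ r′)
    with refl ← ↦-functional v↦w v↦w′ = cong suc (RootPath-unique r r′)

  RootPath-positive : ∀ {v h} → RootPath p v h → 1 ≤ h
  RootPath-positive (root _)   = s≤s z≤n
  RootPath-positive (step _ _) = s≤s z≤n

  ↦*-RootPath : ∀ {x a h} → x ↦* a → RootPath p x h → ∃ λ h′ → RootPath p a h′ × h′ ≤ h
  ↦⁺-RootPath : ∀ {x a h} → x ↦⁺ a → RootPath p x h → ∃ λ h′ → RootPath p a h′ × h′ < h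

  ↦*-RootPath ε r = _ , r , ≤-refl
  ↦*-RootPath (x↦w ◅ w↦*a) r with h′ , r′ , h′<h ← ↦⁺-RootPath (_ , x↦w , w↦*a) r =
    h′ , r′ , <⇒≤ h′<h

  ↦⁺-RootPath (_ , x↦w , _)    (root x↦∅) with () ← trans (sym x↦w) x↦∅
  ↦⁺-RootPath (_ , x↦w , w↦*a) (step x↦w′ r)
    with refl ← ↦-functional x↦w x↦w′
    with h′ , r′ , h′≤h ← ↦*-RootPath w↦*a r = h′ , r′ , s≤s h′≤h

  ↦⁺-irrefl : ∀ {x h} → RootPath p x h → ¬ x ↦⁺ x
  ↦⁺-irrefl r x↦⁺x with h′ , r′ , h′<h ← ↦⁺-RootPath x↦⁺x r =
    <-irrefl (RootPath-unique r′ r) h′<h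

module ForestDepth (F : RootedForest) where
  open Ancestry (parent F) public
  open import Data.List.Membership.Propositional using () renaming (_∈_ to _∈ˡ_)
  open import Data.List.Membership.Propositional.Properties using (∈-∃++)

  depth : Fin (m F) → ℕ
  depth v = proj₁ (toRoot F v)

  depth-RootPath : ∀ v → RootPath (parent F) v (depth v)
  depth-RootPath v = proj₂ (toRoot F v)

  depth-positive : ∀ v → 1 ≤ depth v
  depth-positive v = RootPath-positive (depth-RootPath v)

  tdAtLeast⇒deep : ∀ {G h} → ClosureContains F G → TdAtLeast G (suc h) → ∃ λ v → suc h ≤ depth v
  tdAtLeast⇒deep {G} {h} closure td with any? (λ v → suc h ≤? depth v)
  ... | yes deep = deep
  ... | no  none = ⊥-elim (1+n≰n (td F h closure shallow))
    where
    shallow : HeightAtMost F h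
    shallow v k r rewrite RootPath-unique r (depth-RootPath v) = ≮⇒≥ (λ h<dv → none (v , h<dv))

  ↦⁺-depth : ∀ {x a} → x ↦⁺ a → depth a < depth x
  ↦⁺-depth {x} {a} x↦⁺a with h , r , h<dx ← ↦⁺-RootPath x↦⁺a (depth-RootPath x) =
    subst (_< depth x) (RootPath-unique r (depth-RootPath a)) h<dx

  Ancestor⇒↦⁺ : ∀ {a x} → Ancestor F a x → x ↦⁺ a
  Ancestor⇒↦⁺ (par x↦a)    = _ , x↦a , ε
  Ancestor⇒↦⁺ (up x↦w w<a) = _ , x↦w , ↦⁺⇒↦* (Ancestor⇒↦⁺ w<a)

  ↦⁺⇒Ancestor : ∀ {a x} → x ↦⁺ a → Ancestor F a x
  ↦⁺⇒Ancestor (_ , x↦w , w↦*a) = climb x↦w w↦*a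
    where
    climb : ∀ {x w a} → x ↦ w → w ↦* a → Ancestor F a x
    climb x↦a ε              = par x↦a
    climb x↦w (w↦v ◅ v↦*a) = up x↦w (climb w↦v v↦*a)

  Comparable⇒Ancestor : ∀ {x y} → Comparable x y → x ≢ y → Ancestor F x y ⊎ Ancestor F y x
  Comparable⇒Ancestor (inj₁ y↦*x) x≢y = inj₁ (↦⁺⇒Ancestor (↦*-≢⇒↦⁺ y↦*x (≢-sym x≢y)))
  Comparable⇒Ancestor (inj₂ x↦*y) x≢y = inj₂ (↦⁺⇒Ancestor (↦*-≢⇒↦⁺ x↦*y x≢y))

  Ancestor⇒Comparable : ∀ {x y} → Ancestor F x y ⊎ Ancestor F y x → Comparable x y
  Ancestor⇒Comparable = Sum.map (↦⁺⇒↦* ∘ Ancestor⇒↦⁺) (↦⁺⇒↦* ∘ Ancestor⇒↦⁺)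

  topmost : ∀ {x xs} → Linked Comparable (x ∷ xs) → ∃ λ b → b ∈ˡ x ∷ xs × All (_↦* b) (x ∷ xs)
  topmost [-] = _ , here refl , ε ∷ []
  topmost (x~y ∷ l) with b , b∈ , all@(y↦*b ∷ _) ← topmost l with x~y
  ... | inj₂ x↦*y = b , there b∈ , (x↦*y ◅◅ y↦*b) ∷ all
  ... | inj₁ y↦*x with ↦*-comparable y↦*x y↦*b
  ...   | inj₂ x↦*b = b , there b∈ , x↦*b ∷ all
  ...   | inj₁ b↦*x = _ , here refl , ε ∷ All.map (_◅◅ b↦*x) all

  record Chain (r : Fin (m F)) (j : ℕ) : Set where
    field
      vertices : List (Fin (m F))
      linked   : Linked Comparable vertices
      unique   : Unique vertices
      below    : All (_↦⁺ r) vertices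
      long     : 2 ^ j ≤ suc (length vertices)

  private
    strictlyBelow : ∀ {b xs} → All (_↦* b) xs → All (_≢ b) xs → All (_↦⁺ b) xs
    strictlyBelow below ≢b = All.zipWith (λ (x↦*b , x≢b) → ↦*-≢⇒↦⁺ x↦*b x≢b) (below , ≢b)

  splitAtTop : ∀ {j b xs} → b ∈ˡ xs → Linked Comparable xs → Unique xs → All (_↦* b) xs →
               2 ^ suc j ≤ suc (length xs) → Chain b j
  splitAtTop {j} {b} b∈xs l u below-b long
    with ls , rs , refl ← ∈-∃++ b∈xs
    with linked-ls , linked-b∷rs ← Linked-++⁻ ls l
    with unique-ls , (b∉rs ∷ unique-rs) , ls∉b∷rs ← AllPairs-++⁻ ls u
    with longerSide j ls b rs long
  ... | inj₁ left  = record
    { vertices = ls ; linked = linked-ls ; unique = unique-ls ; long = left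
    ; below    = strictlyBelow (All.++⁻ˡ ls below-b) (All.map All.head ls∉b∷rs) }
  ... | inj₂ right = record
    { vertices = rs ; linked = Linked.tail linked-b∷rs ; unique = unique-rs ; long = right
    ; below    = strictlyBelow (All.tail (All.++⁻ʳ ls below-b)) (All.map ≢-sym b∉rs) }

  halve : ∀ {j xs} → Linked Comparable xs → Unique xs → 2 ^ suc j ≤ suc (length xs) →
          ∃ λ b → b ∈ˡ xs × Chain b j
  halve {j} {[]}         _ _ long =
    ⊥-elim (1+n≰n (≤-trans (^-monoʳ-≤ 2 {1} {suc j} (s≤s z≤n)) long))
  halve {j} {xs@(_ ∷ _)} l u long with b , b∈xs , below-b ← topmost l =
    b , b∈xs , splitAtTop b∈xs l u below-b long

  Chain⇒deep : ∀ {r} j → Chain r j → ∃ λ v → depth r + j ≤ depth v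
  Chain⇒deep {r} zero    _ = r , ≤-reflexive (+-identityʳ (depth r))
  Chain⇒deep {r} (suc j) c
    with b , b∈ , c′ ← halve (Chain.linked c) (Chain.unique c) (Chain.long c)
    with v , deep ← Chain⇒deep j c′ = v , (begin
      depth r + suc j   ≡⟨ +-suc (depth r) j ⟩
      suc (depth r) + j ≤⟨ +-monoˡ-≤ j (↦⁺-depth (All.lookup (Chain.below c) b∈)) ⟩
      depth b + j       ≤⟨ deep ⟩
      depth v           ∎)
    where open ≤-Reasoning

  comparablePath⇒deep : ∀ {j xs} → Linked Comparable xs → Unique xs →
                        2 ^ suc j ≤ suc (length xs) → ∃ λ v → suc j ≤ depth v
  comparablePath⇒deep {j} l u long
    with b , _ , chain ← halve l u long
    with v , deep ← Chain⇒deep j chain =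
    v , ≤-trans (+-monoˡ-≤ j (depth-positive b)) deep

Consecutive-irrefl : ∀ {k} {i : Fin k} → ¬ Consecutive i i
Consecutive-irrefl = 1+n≢n ∘ sym

PathG : ℕ → Graph
PathG k = record
  { n      = k
  ; Adj    = λ i j → Consecutive i j ⊎ Consecutive j i
  ; dec    = λ i j → (toℕ j ≟ suc (toℕ i)) ⊎-dec (toℕ i ≟ suc (toℕ j))
  ; sym    = Sum.swap
  ; irrefl = [ Consecutive-irrefl , Consecutive-irrefl ]′
  }

isEven : ℕ → Bool
isEven zero    = true
isEven (suc i) = not (isEven i)

PathG-bipartite : ∀ k → Bipartite (PathG k)
PathG-bipartite k = isEven ∘ toℕ , [ differ , ≢-sym ∘ differ ]′
  where
  differ : ∀ {i j : Fin k} → Consecutive i j → isEven (toℕ i) ≢ isEven (toℕ j)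
  differ i→j rewrite i→j = not-¬ refl

PathG-td : ∀ j k → 2 ^ j ≤ suc k → TdAtLeast (PathG k) j
PathG-td zero    k _    F h _                   _      = z≤n
PathG-td (suc j) k long F h (f , f-inj , f-adj) height =
  ≤-trans (proj₂ deepest) (height _ _ (depth-RootPath (proj₁ deepest)))
  where
  open ForestDepth F
  path : Linked Comparable (tabulate f)
  path = Linked-tabulate⁺ (λ i→j → Ancestor⇒Comparable (f-adj (inj₁ i→j)))
  long′ : 2 ^ suc j ≤ suc (length (tabulate f))
  long′ = subst (λ l → 2 ^ suc j ≤ suc l) (sym (length-tabulate f)) long
  deepest : ∃ λ v → suc j ≤ depth v
  deepest = comparablePath⇒deep path (Unique.tabulate⁺ f-inj) long′

record NormalSpanningForest (G : Graph) : Set where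
  field
    parentOf    : Parent (n G)
    reachesRoot : ∀ v → ∃ λ h → RootPath parentOf v h
    tree-edge   : ∀ {v w} → parentOf v ≡ just w → Adj G w v
    comparable  : ∀ {x y} → Adj G x y → Ancestry.Comparable parentOf x y

module DepthFirstSearch (G : Graph) where

  record State : Set where
    field
      unvisited : Subset (n G)
      parentOf  : Parent (n G)
      level     : Fin (n G) → ℕ
      active    : Maybe (Fin (n G))

    activeLevel : ℕ
    activeLevel = maybe′ level 0 active

    -- visit removes a vertex from unvisited but raises activeLevel by one; retreat lowers it.
    measure : ℕ
    measure = ∣ unvisited ∣ + ∣ unvisited ∣ + activeLevel

  open State

  record Invariant (s : State) : Set where
    open Ancestry (parentOf s)
    field
      parent-visited  : ∀ {v w} → v ↦ w → v ∉ unvisited s × w ∉ unvisited s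
      parent-adjacent : ∀ {v w} → v ↦ w → Adj G w v
      level-parent    : ∀ {v w} → v ↦ w → level s v ≡ suc (level s w)
      level-root      : ∀ {v} → parentOf s v ≡ nothing → level s v ≡ 1
      active-visited  : ∀ {c} → active s ≡ just c → c ∉ unvisited s
      -- Every edge leaving the visited vertices starts on the branch above the active vertex.
      frontier        : ∀ {x y} → x ∉ unvisited s → y ∈ unvisited s → Adj G x y →
                        ∃ λ c → active s ≡ just c × c ↦* x
      closed          : ∀ {x y} → x ∉ unvisited s → y ∉ unvisited s → Adj G x y → Comparable x y

  initial : State
  initial = record { unvisited = ⊤ ; parentOf = const nothing ; level = const 1 ; active = nothing }

  initial-invariant : Invariant initial
  initial-invariant = record
    { parent-visited  = λ ()
    ; parent-adjacent = λ ()
    ; level-parent    = λ ()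
    ; level-root      = λ _ → refl
    ; active-visited  = λ ()
    ; frontier        = λ x∉⊤ _ _ → ⊥-elim (x∉⊤ ∈⊤)
    ; closed          = λ x∉⊤ _ _ → ⊥-elim (x∉⊤ ∈⊤)
    }

  visit : State → Fin (n G) → State
  visit s u = record
    { unvisited = unvisited s - u
    ; parentOf  = updateAt (parentOf s) u (const (active s))
    ; level     = updateAt (level s) u (const (suc (activeLevel s)))
    ; active    = just u
    }

  retreat : State → Fin (n G) → State
  retreat s c = record s { active = parentOf s c }

  module Visit (s : State) (I : Invariant s) (u : Fin (n G)) (u∈ : u ∈ unvisited s)
               (active-adj : ∀ {c} → active s ≡ just c → Adj G c u) where
    open Invariant I
    open Ancestry (parentOf s)
    module New = Ancestry (parentOf (visit s u))

    visited-≢ : ∀ {x} → x ∉ unvisited s → x ≢ u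
    visited-≢ x∉ refl = x∉ u∈

    stays-visited : ∀ {x} → x ∉ unvisited s → x ∉ unvisited (visit s u)
    stays-visited x∉ x∈ = x∉ (p─q⊆p (unvisited s) ⁅ u ⁆ x∈)

    u-visited : u ∉ unvisited (visit s u)
    u-visited = x∉p-x (unvisited s) u

    newly-visited : ∀ {x} → x ∉ unvisited (visit s u) → x ≡ u ⊎ x ∉ unvisited s
    newly-visited {x} x∉ with x ≟ᶠ u
    ... | yes x≡u = inj₁ x≡u
    ... | no  x≢u = inj₂ (λ x∈ → x∉ (x∈p∧x≢y⇒x∈p-y x∈ x≢u))

    new-parent-u : parentOf (visit s u) u ≡ active s
    new-parent-u = updateAt-updates u (parentOf s)

    new-level-u : level (visit s u) u ≡ suc (activeLevel s)
    new-level-u = updateAt-updates u (level s)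

    new-parent : ∀ {v w} → v New.↦ w → (v ≡ u × active s ≡ just w) ⊎ (v ≢ u × v ↦ w)
    new-parent {v} v↦w with v ≟ᶠ u
    ... | yes refl = inj₁ (refl , trans (sym new-parent-u) v↦w)
    ... | no  v≢u  = inj₂ (v≢u , trans (sym (updateAt-minimal v u (parentOf s) v≢u)) v↦w)

    ↦*-extends : ∀ {x a} → x ↦* a → x New.↦* a
    ↦*-extends = Star.map λ {v} v↦w →
      trans (updateAt-minimal v u (parentOf s) (visited-≢ (proj₁ (parent-visited v↦w)))) v↦w

    below-u : ∀ {x} → (∃ λ c → active s ≡ just c × c ↦* x) → u New.↦* x
    below-u (c , active≡c , c↦*x) =
      trans new-parent-u active≡c ◅ ↦*-extends c↦*x

    visited-level : ∀ {v} → v ∉ unvisited s → level (visit s u) v ≡ level s v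
    visited-level v∉ = updateAt-minimal _ u (level s) (visited-≢ v∉)

    new-level-parent : ∀ {v w} → v New.↦ w → level (visit s u) v ≡ suc (level (visit s u) w)
    new-level-parent v↦w with new-parent v↦w
    ... | inj₁ (refl , active≡w) = begin
      level (visit s u) u                ≡⟨ new-level-u ⟩
      suc (maybe′ (level s) 0 (active s)) ≡⟨ cong (suc ∘ maybe′ (level s) 0) active≡w ⟩
      suc (level s _)                    ≡⟨ cong suc (sym (visited-level (active-visited active≡w))) ⟩
      suc (level (visit s u) _)          ∎
      where open ≡-Reasoning
    ... | inj₂ (v≢u , v↦w) = begin
      level (visit s u) _       ≡⟨ updateAt-minimal _ u (level s) v≢u ⟩
      level s _                 ≡⟨ level-parent v↦w ⟩
      suc (level s _)           ≡⟨ cong suc (sym (visited-level (proj₂ (parent-visited v↦w)))) ⟩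
      suc (level (visit s u) _) ∎
      where open ≡-Reasoning

    new-level-root : ∀ {v} → parentOf (visit s u) v ≡ nothing → level (visit s u) v ≡ 1
    new-level-root {v} v↦∅ with v ≟ᶠ u
    ... | yes refl = trans new-level-u (cong (suc ∘ maybe′ (level s) 0) (trans (sym new-parent-u) v↦∅))
    ... | no  v≢u  = trans (updateAt-minimal v u (level s) v≢u)
                       (level-root (trans (sym (updateAt-minimal v u (parentOf s) v≢u)) v↦∅))

    invariant : Invariant (visit s u)
    invariant = record
      { parent-visited  = λ v↦w → case new-parent v↦w of λ where
          (inj₁ (refl , active≡w)) → u-visited , stays-visited (active-visited active≡w)
          (inj₂ (_ , v↦w))          → Product.map stays-visited stays-visited (parent-visited v↦w)
      ; parent-adjacent = λ v↦w → case new-parent v↦w of λ where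
          (inj₁ (refl , active≡w)) → active-adj active≡w
          (inj₂ (_ , v↦w))          → parent-adjacent v↦w
      ; level-parent    = new-level-parent
      ; level-root      = new-level-root
      ; active-visited  = λ { refl → u-visited }
      ; frontier        = λ x∉ y∈ x~y → case newly-visited x∉ of λ where
          (inj₁ refl) → u , refl , ε
          (inj₂ x∉s)  → u , refl , below-u (frontier x∉s (p─q⊆p (unvisited s) ⁅ u ⁆ y∈) x~y)
      ; closed          = λ x∉ y∉ x~y → case newly-visited x∉ , newly-visited y∉ of λ where
          (inj₁ refl , inj₁ refl) → ⊥-elim (irrefl G x~y)
          (inj₁ refl , inj₂ y∉s)  → inj₂ (below-u (frontier y∉s u∈ (Graph.sym G x~y)))
          (inj₂ x∉s  , inj₁ refl) → inj₁ (below-u (frontier x∉s u∈ x~y))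
          (inj₂ x∉s  , inj₂ y∉s)  → Sum.map ↦*-extends ↦*-extends (closed x∉s y∉s x~y)
      }

    decreasing : measure (visit s u) < measure s
    decreasing rewrite new-level-u =
      m<n⇒m+m+suc[o]<n+n+o (activeLevel s) (x∈p⇒∣p-x∣<∣p∣ u∈)

  module Retreat (s : State) (I : Invariant s) (c : Fin (n G)) (active≡c : active s ≡ just c)
                 (stuck : ∀ {y} → y ∈ unvisited s → ¬ Adj G c y) where
    open Invariant I
    open Ancestry (parentOf s)

    invariant : Invariant (retreat s c)
    invariant = record
      { parent-visited  = parent-visited
      ; parent-adjacent = parent-adjacent
      ; level-parent    = level-parent
      ; level-root      = level-root
      ; active-visited  = proj₂ ∘ parent-visited
      ; frontier        = new-frontier
      ; closed          = closed
      }
      where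
      new-frontier : ∀ {x y} → x ∉ unvisited s → y ∈ unvisited s → Adj G x y →
                     ∃ λ w → parentOf s c ≡ just w × w ↦* x
      new-frontier x∉ y∈ x~y with frontier x∉ y∈ x~y
      ... | c′ , active≡c′ , c′↦*x
            with refl ← just-injective (trans (sym active≡c) active≡c′) with c′↦*x
      ... | ε               = ⊥-elim (stuck y∈ x~y)
      ... | c↦w ◅ w↦*x      = _ , c↦w , w↦*x

    decreasing : measure (retreat s c) < measure s
    decreasing rewrite active≡c = +-monoʳ-< (∣ unvisited s ∣ + ∣ unvisited s ∣) below-c
      where
      below-c : maybe′ (level s) 0 (parentOf s c) < level s c
      below-c with parentOf s c in c↦
      ... | just w  = ≤-reflexive (sym (level-parent c↦))
      ... | nothing = ≤-reflexive (sym (level-root c↦))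

  Finished : State → Set
  Finished s = Empty (unvisited s)

  advance : ∀ s → Invariant s → Finished s ⊎ ∃ λ s′ → Invariant s′ × measure s′ < measure s
  advance s@record { active = nothing } I with nonempty? (unvisited s)
  ... | no  none     = inj₁ none
  ... | yes (u , u∈) =
    inj₂ (_ , Visit.invariant s I u u∈ (λ ()) , Visit.decreasing s I u u∈ (λ ()))
  advance s@record { active = just c } I with any? (λ y → y ∈? unvisited s ×-dec dec G c y)
  ... | yes (y , y∈ , c~y) =
    inj₂ (_ , Visit.invariant s I y y∈ adj , Visit.decreasing s I y y∈ adj)
    where
    adj : ∀ {c′} → just c ≡ just c′ → Adj G c′ y
    adj refl = c~y
  ... | no  none =
    inj₂ (_ , Retreat.invariant s I c refl stuck , Retreat.decreasing s I c refl stuck)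
    where
    stuck : ∀ {y} → y ∈ unvisited s → ¬ Adj G c y
    stuck y∈ c~y = none (_ , y∈ , c~y)

  run : ∀ s → Invariant s → Acc _<_ (measure s) → ∃ λ s′ → Invariant s′ × Finished s′
  run s I (acc more) with advance s I
  ... | inj₁ done             = s , I , done
  ... | inj₂ (s′ , I′ , s′<s) = run s′ I′ (more s′<s)

  Invariant⇒RootPath : ∀ {s} → Invariant s → ∀ v → RootPath (parentOf s) v (level s v)
  Invariant⇒RootPath {s} I v = rootPath (level s v) v refl
    where
    open Invariant I
    rootPath : ∀ h v → level s v ≡ h → RootPath (parentOf s) v h
    rootPath h       v lv≡h with parentOf s v in v↦
    rootPath h       v lv≡h | nothing =
      subst (RootPath (parentOf s) v) (trans (sym (level-root v↦)) lv≡h) (root v↦)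
    rootPath zero    v lv≡h | just w  = ⊥-elim (1+n≢0 (trans (sym (level-parent v↦)) lv≡h))
    rootPath (suc h) v lv≡h | just w  =
      step v↦ (rootPath h w (suc-injective (trans (sym (level-parent v↦)) lv≡h)))

  normalSpanningForest : NormalSpanningForest G
  normalSpanningForest with s , I , done ← run initial initial-invariant (<-wellFounded _) = record
    { parentOf    = parentOf s
    ; reachesRoot = λ v → level s v , Invariant⇒RootPath I v
    ; tree-edge   = parent-adjacent
    ; comparable  = closed (λ x∈ → done (_ , x∈)) (λ y∈ → done (_ , y∈))
    }
    where open Invariant I

module _ {G : Graph} (T : NormalSpanningForest G) where
  open NormalSpanningForest T

  forest : RootedForest
  forest = record { m = n G ; parent = parentOf ; toRoot = reachesRoot }

  open ForestDepth forest

  closureContains : ClosureContains forest G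
  closureContains =
    id , id , λ x~y → Comparable⇒Ancestor (comparable x~y) (λ { refl → irrefl G x~y })

  walk : ∀ {v h} → RootPath parentOf v h → Fin h → Fin (n G)
  walk {v} _          zero    = v
  walk     (root _)   (suc ())
  walk     (step _ r) (suc i) = walk r i

  walk-↦* : ∀ {v h} (r : RootPath parentOf v h) i → v ↦* walk r i
  walk-↦* _          zero    = ε
  walk-↦* (step v↦ r) (suc i) = v↦ ◅ walk-↦* r i

  walk-injective : ∀ {v h} (r : RootPath parentOf v h) → Injective _≡_ _≡_ (walk r)
  walk-injective r          {zero}  {zero}  _  = refl
  walk-injective (step v↦ r) {zero}  {suc j} eq =
    ⊥-elim (↦⁺-irrefl (step v↦ r) (_ , v↦ , subst (_ ↦*_) (sym eq) (walk-↦* r j)))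
  walk-injective (step v↦ r) {suc i} {zero}  eq =
    ⊥-elim (↦⁺-irrefl (step v↦ r) (_ , v↦ , subst (_ ↦*_) eq (walk-↦* r i)))
  walk-injective (step v↦ r) {suc i} {suc j} eq = cong suc (walk-injective r eq)

  walk-adjacent : ∀ {v h} (r : RootPath parentOf v h) {i j} →
                  Consecutive i j → Adj G (walk r i) (walk r j)
  walk-adjacent (step v↦ r) {zero}  {suc zero} _  = Graph.sym G (tree-edge v↦)
  walk-adjacent (step v↦ r) {suc i} {suc j}    eq = walk-adjacent r (suc-injective eq)

  RootPath⇒path : ∀ {v h} → RootPath parentOf v h → PathG h ⊆ᴳ G
  RootPath⇒path r =
    walk r , walk-injective r , [ walk-adjacent r , Graph.sym G ∘ walk-adjacent r ]′

  longPath : ∀ {K} → 1 ≤ K → TdAtLeast G K → ∃ λ k → K ≤ k × PathG k ⊆ᴳ G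
  longPath {suc h} _ td with v , deep ← tdAtLeast⇒deep {G} closureContains td =
    depth v , deep , RootPath⇒path (depth-RootPath v)

mainTheorem12 : (n : ℕ) → 1 ≤ n → (G : Graph) → TdAtLeast G (2 ^ n ∸ 1) →
    Σ Graph (λ Ĝ → (Ĝ ⊆ᴳ G) × Bipartite Ĝ × TdAtLeast Ĝ n)
mainTheorem12 n 1≤n G td =
  let k , 2ⁿ-1≤k , Pₖ⊆G = longPath (DepthFirstSearch.normalSpanningForest G) 1≤2ⁿ-1 td
  in  PathG k , Pₖ⊆G , PathG-bipartite k , PathG-td n k (≤-trans (m≤n+m∸n (2 ^ n) 1) (s≤s 2ⁿ-1≤k))
  where
  1≤2ⁿ-1 : 1 ≤ 2 ^ n ∸ 1
  1≤2ⁿ-1 = ∸-monoˡ-≤ 1 (^-monoʳ-≤ 2 1≤n)
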